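{- Let $F$ be a Morse stack on a normal $d$-pseudomanifold $M$. Then the watershed forest of $F$ is a minimum spanning forest for $\mathfrak{min}(F)$. Furthermore, it is the unique minimum spanning forest for $\mathfrak{min}(F)$.
   Context: A simplex is a non-empty finite set; its dimension is its cardinality minus one. A complex is a finite set $X$ of simplexes closed under taking non-empty subsets; elements are faces; facets are maximal faces; a subcomplex is a subset that is a complex. A covering pair (or $p$-pair) is a pair $(x,y)$ of faces with $x\subseteq y$, $\dim y=p$, $\dim x=p-1$; it is a free pair of $X$ if $y$ is the only face of $X$ other than $x$ containing $x$. A path in a set of simplexes is a sequence with consecutive elements comparable for inclusion; connected components are defined via such paths; a strong $d$-path is a path whose consecutive elements form $d$-pairs in one order or the other. A subset of $X$ is open if closed under supersets within $X$. A normal $d$-pseudomanifold ($d\ge1$) is a connected complex $M$ whose facets all have dimension $d$, in which each $(d-1)$-face lies in exactly two $d$-faces, and every connected open subset $S$ is strongly connected (any two facets of $S$ joined by a strong $d$-path in $S$). A stack on $X$ is $F:X\to\mathbb Z$ with $F(x)\ge F(y)$ whenever $x\subseteq y$; $F[\lambda]=\{x:F(x)\ge\lambda\}$; a minimum of $F$ (at altitude $\lambda$) is a connected component $A$ of $X\setminus F[\lambda+1]$ with $A\cap(X\setminus F[\lambda])=\emptyset$; $\mathfrak{min}(F)$ is the union of the minima. A flat pair is a covering pair $(x,y)$ with $F(x)=F(y)$; $F$ is a Morse stack if each face is in at most one flat pair. If $(x,y)$ is a covering pair with $F(x)>F(y)$, then $(y,x)$ is a differential pair. For a Morse stack on $M$,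 every minimum is of the form $\{m\}$ with $m$ a $d$-face. A graph is a complex of dimension at most 1. The facet graph $\Upsilon_M$ of $M$ has vertices $\{x\}$ for the $d$-faces $x$ of $M$ and edges $\{x,y\}$ for the pairs of $d$-faces with $x\cap y$ a $(d-1)$-face. For a nonempty set $R$ of vertices and a graph $Y$ with $R\subseteq Y$, $Y$ is a forest rooted by $R$ if either $Y=R$, or there is a free pair $(v,e)$ of $Y$ (a vertex $v$ and an edge $e$) such that $Y\setminus\{v,e\}$ contains $R$ and is a forest rooted by $R$. With $R=\{\{m\}: m\in\mathfrak{min}(F)\}$, a subgraph $Y$ of $\Upsilon_M$ is a spanning forest for $\mathfrak{min}(F)$ if it is a forest rooted by $R$ containing all vertices of $\Upsilon_M$. Its weight is $\sum F(x\cap y)$ over the edges $\{x,y\}$ of $Y$; it is a minimum spanning forest for $\mathfrak{min}(F)$ if its weight is minimal among all spanning forests for $\mathfrak{min}(F)$. The watershed forest of $F$ is the subgraph $G$ of $\Upsilon_M$ containing all vertices of $\Upsilon_M$ and exactly those edges $\{x,y\}$ such that either ($(x,x\cap y)$ is a differential pair and $(x\cap y,y)$ is a flat pair) or ($(y,x\cap y)$ is a differential pair and $(x\cap y,x)$ is a flat pair). -}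

module Defs where

open import Data.Nat as ℕ using (ℕ; zero; suc)
open import Data.Integer as ℤ using (ℤ; 0ℤ; _+_; _<_; _≤_)
open import Data.Bool using (Bool; true; false; _∧_; _∨_; not; if_then_else_)
import Data.Bool as B
open import Data.Vec using ([]; _∷_)
open import Data.Vec.Properties using (≡-dec)
open import Data.Fin.Subset using (Subset; _⊆_; _∩_; ∣_∣; Nonempty)
open import Data.List using (List; []; _∷_; map; _++_; foldr)
open import Data.Product using (Σ; ∃; _×_; _,_)
open import Data.Sum using (_⊎_)
open import Relation.Nullary using (¬_; Dec)
open import Relation.Nullary.Decidable using (⌊_⌋)
open import Relation.Binary.PropositionalEquality using (_≡_; _≢_)
open import Function.Bundles using (_⇔_)
open import Level using (Level)

-- Simplexes on the vertex set Fin n are (non-empty) subsets 'Subset n';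
-- the cardinality of a simplex x is ∣ x ∣, so  dim x = ∣ x ∣ - 1.
-- A (finite) set of simplexes with decidable membership is a map
-- 'Subset n → Bool'; an arbitrary set of simplexes is a predicate.

_≟ˢ_ : ∀ {n} (x y : Subset n) → Dec (x ≡ y)
_≟ˢ_ = ≡-dec B._≟_

SimplexSet : ℕ → Set₁
SimplexSet n = Subset n → Set

_∈ᶜ_ : ∀ {n} → Subset n → (Subset n → Bool) → Set
x ∈ᶜ X = X x ≡ true

IsComplex : ∀ {n} → (Subset n → Bool) → Set
IsComplex X =
  (∀ x → x ∈ᶜ X → Nonempty x) ×
  (∀ x y → y ∈ᶜ X → Nonempty x → x ⊆ y → x ∈ᶜ X)

IsFacetOf : ∀ {n} → SimplexSet n → Subset n → Set
IsFacetOf S x = S x × (∀ y → S y → x ⊆ y → y ≡ x)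

IsCoveringPair : ∀ {n} → (Subset n → Bool) → Subset n → Subset n → Set
IsCoveringPair X x y = x ∈ᶜ X × y ∈ᶜ X × x ⊆ y × ∣ y ∣ ≡ suc ∣ x ∣

IsDPair : ∀ {n} → ℕ → (Subset n → Bool) → Subset n → Subset n → Set
IsDPair d X x y = IsCoveringPair X x y × ∣ y ∣ ≡ suc d × ∣ x ∣ ≡ d

IsDFace : ∀ {n} → ℕ → (Subset n → Bool) → Subset n → Set
IsDFace d X x = x ∈ᶜ X × ∣ x ∣ ≡ suc d

data PathBy {n} (S : SimplexSet n) (R : Subset n → Subset n → Set)
       : Subset n → Subset n → Set where
  [_]  : ∀ {x} → S x → PathBy S R x x
  _∷⟨_⟩_ : ∀ {x y z} → S x → R x y → PathBy S R y z → PathBy S R x z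

Comparable : ∀ {n} → Subset n → Subset n → Set
Comparable x y = x ⊆ y ⊎ y ⊆ x

Path : ∀ {n} → SimplexSet n → Subset n → Subset n → Set
Path S = PathBy S Comparable

StrongPath : ∀ {n} → ℕ → (Subset n → Bool) → SimplexSet n →
             Subset n → Subset n → Set
StrongPath d X S = PathBy S (λ x y → IsDPair d X x y ⊎ IsDPair d X y x)

IsConnected : ∀ {n} → SimplexSet n → Set
IsConnected S = (∃ λ x → S x) × (∀ x y → S x → S y → Path S x y)

IsComponent : ∀ {n} → SimplexSet n → SimplexSet n → Set
IsComponent S A =
  (∃ λ x → A x) × (∀ x → A x → S x) ×
  (∀ a s → A a → (A s ⇔ Path S a s))

IsOpen : ∀ {n} → (Subset n → Bool) → SimplexSet n → Set
IsOpen X S = (∀ x → S x → x ∈ᶜ X) × (∀ x y → S x → y ∈ᶜ X → x ⊆ y → S y)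

IsStronglyConnected : ∀ {n} → ℕ → (Subset n → Bool) → SimplexSet n → Set
IsStronglyConnected d X S =
  ∀ x y → IsFacetOf S x → IsFacetOf S y → StrongPath d X S x y

IsNormalPseudomanifold : ∀ {n} → ℕ → (Subset n → Bool) → Set₁
IsNormalPseudomanifold {n} d M =
  1 ℕ.≤ d ×
  IsComplex M ×
  IsConnected (_∈ᶜ M) ×
  (∀ x → IsFacetOf (_∈ᶜ M) x → ∣ x ∣ ≡ suc d) ×
  (∀ x → x ∈ᶜ M → ∣ x ∣ ≡ d →
     Σ (Subset n) λ y₁ → Σ (Subset n) λ y₂ →
       y₁ ≢ y₂ × IsDFace d M y₁ × x ⊆ y₁ × IsDFace d M y₂ × x ⊆ y₂ ×
       (∀ y → IsDFace d M y → x ⊆ y → y ≡ y₁ ⊎ y ≡ y₂)) ×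
  (∀ S → IsOpen M S → IsConnected S → IsStronglyConnected d M S)

IsStack : ∀ {n} → (Subset n → Bool) → (Subset n → ℤ) → Set
IsStack X F = ∀ x y → x ∈ᶜ X → y ∈ᶜ X → x ⊆ y → F y ≤ F x

IsFlatPair : ∀ {n} → (Subset n → Bool) → (Subset n → ℤ) →
             Subset n → Subset n → Set
IsFlatPair X F x y = IsCoveringPair X x y × F x ≡ F y

IsDifferentialPair : ∀ {n} → (Subset n → Bool) → (Subset n → ℤ) →
                     Subset n → Subset n → Set
IsDifferentialPair X F y x = IsCoveringPair X x y × F y < F x

IsMorseStack : ∀ {n} → (Subset n → Bool) → (Subset n → ℤ) → Set
IsMorseStack X F =
  IsStack X F ×
  (∀ z x y x′ y′ → IsFlatPair X F x y → IsFlatPair X F x′ y′ →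
     (z ≡ x ⊎ z ≡ y) → (z ≡ x′ ⊎ z ≡ y′) → x ≡ x′ × y ≡ y′)

IsMinimumAt : ∀ {n} → (Subset n → Bool) → (Subset n → ℤ) → ℤ →
              SimplexSet n → Set
IsMinimumAt X F λ′ A =
  IsComponent (λ x → x ∈ᶜ X × F x ≤ λ′) A ×   -- X \ F[λ+1]
  (∀ x → A x → λ′ ≤ F x)                      -- A ∩ (X \ F[λ]) = ∅

InMin : ∀ {n} → (Subset n → Bool) → (Subset n → ℤ) → Subset n → Set₁
InMin X F m = Σ ℤ λ λ′ → Σ (SimplexSet _) λ A → IsMinimumAt X F λ′ A × A m

-- Graphs on the facets.  A vertex {x} of the facet graph is represented
-- by the d-face x itself, an edge {x,y} by E x y ≡ true (and symmetric).

record Graph (n : ℕ) : Set where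
  field
    V : Subset n → Bool
    E : Subset n → Subset n → Bool
open Graph public

IsFacetEdge : ∀ {n} → ℕ → (Subset n → Bool) → Subset n → Subset n → Set
IsFacetEdge d M x y =
  IsDFace d M x × IsDFace d M y × (x ∩ y) ∈ᶜ M × ∣ x ∩ y ∣ ≡ d

IsSubgraphΥ : ∀ {n} → ℕ → (Subset n → Bool) → Graph n → Set
IsSubgraphΥ d M Y =
  (∀ x → V Y x ≡ true → IsDFace d M x) ×
  (∀ x y → E Y x y ≡ true → IsFacetEdge d M x y) ×
  (∀ x y → E Y x y ≡ true → V Y x ≡ true × V Y y ≡ true) ×
  (∀ x y → E Y x y ≡ E Y y x)

IsFreePair : ∀ {n} → Graph n → Subset n → Subset n → Set
IsFreePair Y v w =
  V Y v ≡ true × E Y v w ≡ true × (∀ u → E Y v u ≡ true → u ≡ w)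

_==_ : ∀ {n} → Subset n → Subset n → Bool
x == y = ⌊ x ≟ˢ y ⌋

removePair : ∀ {n} → Graph n → Subset n → Subset n → Graph n
removePair Y v w = record
  { V = λ x → V Y x ∧ not (x == v)
  ; E = λ x y → E Y x y ∧ not ((x == v ∧ y == w) ∨ (x == w ∧ y == v))
  }

data RootedForest {n ℓ} (R : Subset n → Set ℓ) : Graph n → Set ℓ where
  base : ∀ Y → (∀ x → V Y x ≡ true ⇔ R x) → (∀ x y → E Y x y ≡ false) →
         RootedForest R Y
  step : ∀ Y v w → IsFreePair Y v w →
         (∀ x → R x → V (removePair Y v w) x ≡ true) →
         RootedForest R (removePair Y v w) → RootedForest R Y

IsForestRootedBy : ∀ {n ℓ} → (Subset n → Set ℓ) → Graph n → Set ℓ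
IsForestRootedBy R Y =
  (∃ λ x → R x) × (∀ x → R x → V Y x ≡ true) × RootedForest R Y

IsSpanningForest : ∀ {n} → ℕ → (Subset n → Bool) → (Subset n → ℤ) →
                   Graph n → Set₁
IsSpanningForest d M F Y =
  IsSubgraphΥ d M Y ×
  IsForestRootedBy (InMin M F) Y ×
  (∀ x → IsDFace d M x → V Y x ≡ true)

allSubsets : ∀ n → List (Subset n)
allSubsets zero = [] ∷ []
allSubsets (suc n) = map (true ∷_) (allSubsets n) ++ map (false ∷_) (allSubsets n)

pairs : ∀ {A : Set} → List A → List (A × A)
pairs [] = []
pairs (x ∷ xs) = map (x ,_) xs ++ pairs xs

sumℤ : List ℤ → ℤ
sumℤ = foldr _+_ 0ℤ

weight : ∀ {n} → (Subset n → ℤ) → Graph n → ℤ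
weight {n} F Y =
  sumℤ (map (λ { (x , y) → if E Y x y then F (x ∩ y) else 0ℤ })
            (pairs (allSubsets n)))

IsMinimumSpanningForest : ∀ {n} → ℕ → (Subset n → Bool) → (Subset n → ℤ) →
                          Graph n → Set₁
IsMinimumSpanningForest d M F Y =
  IsSpanningForest d M F Y ×
  (∀ Y′ → IsSpanningForest d M F Y′ → weight F Y ≤ weight F Y′)

IsWatershedForest : ∀ {n} → ℕ → (Subset n → Bool) → (Subset n → ℤ) →
                    Graph n → Set
IsWatershedForest d M F G =
  (∀ x → V G x ≡ true ⇔ IsDFace d M x) ×
  (∀ x y → E G x y ≡ true ⇔
     (IsFacetEdge d M x y ×
      ((IsDifferentialPair M F x (x ∩ y) × IsFlatPair M F (x ∩ y) y) ⊎
       (IsDifferentialPair M F y (x ∩ y) × IsFlatPair M F (x ∩ y) x))))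

_≈ᴳ_ : ∀ {n} → Graph n → Graph n → Set
Y ≈ᴳ G = (∀ x → V Y x ≡ V G x) × (∀ x y → E Y x y ≡ E G x y)

-- Let Φ V be the sum of F over a set V of d-faces, and call a d-face a root if it has no flat
-- (d-1)-face; the roots are exactly the minima of F.  Deleting the free pairs of a rooted forest
-- Y one at a time removes a vertex v with an edge {v , w}, and F v ≤ F (v ∩ w) as F is a stack,
-- so weight F Y ≥ Φ (d-faces) - Φ (roots).  Equality forces every deleted edge to be flat at v,
-- that is, to be the watershed edge leaving v downhill, which is unique by the Morse condition and
-- because a (d-1)-face lies in exactly two d-faces.  The watershed forest attains equality, since
-- a non-root vertex of maximal altitude is always free (nothing descends into it); so it is a
-- minimum spanning forest, and any minimum spanning forest attains equality too, which pins down
-- its edges as the watershed edges.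

module Submission where

open import Defs
open import Data.Nat using (ℕ)
open import Data.Integer using (ℤ)
open import Data.Bool using (Bool)
open import Data.Fin.Subset using (Subset)
open import Data.Product using (_×_)

open import Algebra.Bundles using (CommutativeMonoid)
import Algebra.Properties.CommutativeSemigroup
open import Data.Bool using (true; false; _∧_; _∨_; not; if_then_else_)
import Data.Bool as Bool
open import Data.Bool.Properties
  using (∧-identityʳ; ∧-zeroʳ; ∧-conicalˡ; ∨-zeroʳ; ∧-comm; ∨-comm; ¬-not)
open import Data.Empty using (⊥; ⊥-elim)
import Data.Fin as Fin
open import Data.Fin.Subset using (_⊆_; _∩_; ∣_∣; Nonempty; inside; outside)
  renaming (_∈_ to _∈ˢ_)
open import Data.Fin.Subset.Properties
  using (_∈?_; _⊆?_; ⊆-refl; ⊆-trans; ⊆-antisym; drop-∷-⊆; out⊆; in⊆in; s⊆s; p⊂q⇒∣p∣<∣q∣; p⊆q⇒∣p∣≤∣q∣;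
         p∩q⊆p; p∩q⊆q; x∈p∩q⁺; ∩-comm; ∩-idem; anySubset?)
open import Data.Integer as ℤ using (0ℤ; _+_; _<_; _≤_)
import Data.Integer.Properties as ℤP
open import Data.List using (List; []; _∷_; map; filter; foldr)
open import Data.List.Membership.Propositional using (_∈_; _∉_)
open import Data.List.Membership.Propositional.Properties
  using (∈-map⁺; ∈-map⁻; ∈-++⁺ˡ; ∈-++⁺ʳ; ∈-++⁻; ∈-filter⁺)
import Data.List.Relation.Unary.All as All
open import Data.List.Relation.Unary.All.Properties using (all-filter)
import Data.List.Relation.Unary.AllPairs as AllPairs
open import Data.List.Relation.Unary.Any using (here; there)
open import Data.List.Relation.Unary.Unique.Propositional using (Unique)
import Data.List.Relation.Unary.Unique.Propositional.Properties as Unique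
open import Data.Nat as ℕ using (zero; suc)
open import Data.Nat.Induction using (<-wellFounded)
import Data.Nat.Properties as ℕP
open import Data.Product using (Σ; ∃; _,_; proj₁; proj₂)
open import Data.Sum using (_⊎_; inj₁; inj₂)
open import Data.Vec using ([]; _∷_; here; there)
open import Function using (_∘_)
open import Function.Bundles using (_⇔_; mk⇔; Equivalence)
open import Function.Construct.Composition using (_⇔-∘_)
open import Function.Construct.Symmetry using (⇔-sym)
open import Induction.WellFounded using (Acc; acc)
open import Level using (0ℓ)
open import Relation.Binary.Bundles using (TotalOrder)
import Relation.Binary.Construct.Flip.EqAndOrd as Flip
open import Relation.Binary.PropositionalEquality
  using (_≡_; _≢_; refl; sym; trans; cong; cong₂; subst; ≢-sym; module ≡-Reasoning)
open import Relation.Nullary using (¬_; Dec; does; yes; no; contradiction)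
open import Relation.Nullary.Decidable using (_×-dec_; ¬?; dec-true; dec-false; isYes≗does)
open import Relation.Unary using (Pred; Decidable)

module ℤ-comm = Algebra.Properties.CommutativeSemigroup ℤP.+-commutativeSemigroup

does-true⇒ : ∀ {A : Set} (a? : Dec A) → does a? ≡ true → A
does-true⇒ (yes a) _ = a

≡true-ext : ∀ {a b : Bool} → (a ≡ true ⇔ b ≡ true) → a ≡ b
≡true-ext {false} {false} _ = refl
≡true-ext {false} {true}  a⇔b = Equivalence.from a⇔b refl
≡true-ext {true}          a⇔b = sym (Equivalence.to a⇔b refl)

+-mono-≤-reflects-≡ : ∀ {a b c e : ℤ} → a ≤ b → c ≤ e → a + c ≡ b + e → a ≡ b × c ≡ e
+-mono-≤-reflects-≡ {a} {b} {c} {e} a≤b c≤e a+c≡b+e = a≡b , c≡e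
  where
  a≡b : a ≡ b
  a≡b with a ℤ.≟ b
  ... | yes a≡b = a≡b
  ... | no  a≢b = contradiction a+c≡b+e (ℤP.<⇒≢ (ℤP.+-mono-<-≤ (ℤP.≤∧≢⇒< a≤b a≢b) c≤e))
  c≡e : c ≡ e
  c≡e with c ℤ.≟ e
  ... | yes c≡e = c≡e
  ... | no  c≢e = contradiction a+c≡b+e (ℤP.<⇒≢ (ℤP.+-mono-≤-< a≤b (ℤP.≤∧≢⇒< c≤e c≢e)))

+-cancelʳ-≤ : ∀ {a b} c → a + c ≤ b + c → a ≤ b
+-cancelʳ-≤ {a} {b} c a+c≤b+c with a ℤP.≤? b
... | yes a≤b = a≤b
... | no  a≰b = contradiction a+c≤b+c (ℤP.<⇒≱ (ℤP.+-monoˡ-< c (ℤP.≰⇒> a≰b)))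

p⊆q∧∣q∣≤∣p∣⇒p≡q : ∀ {n} {p q : Subset n} → p ⊆ q → ∣ q ∣ ℕ.≤ ∣ p ∣ → p ≡ q
p⊆q∧∣q∣≤∣p∣⇒p≡q {p = p} p⊆q ∣q∣≤∣p∣ = ⊆-antisym p⊆q q⊆p
  where
  q⊆p : _ ⊆ p
  q⊆p {x} x∈q with x ∈? p
  ... | yes x∈p = x∈p
  ... | no  x∉p =
    contradiction (p⊂q⇒∣p∣<∣q∣ (p⊆q , x , x∈q , x∉p)) (ℕP.≤⇒≯ ∣q∣≤∣p∣)

facet-between : ∀ {n} {p q : Subset n} → p ⊆ q → ∣ p ∣ ℕ.< ∣ q ∣ →
                ∃ λ z → p ⊆ z × z ⊆ q × ∣ q ∣ ≡ suc ∣ z ∣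
facet-between {p = outside ∷ p} {inside ∷ q} p⊆q _ =
  outside ∷ q , s⊆s (drop-∷-⊆ p⊆q) , out⊆ ⊆-refl , refl
facet-between {p = inside ∷ p} {outside ∷ q} p⊆q _ with p⊆q here
... | ()
facet-between {p = inside ∷ p} {inside ∷ q} p⊆q (ℕ.s≤s ∣p∣<∣q∣)
  with facet-between (drop-∷-⊆ p⊆q) ∣p∣<∣q∣
... | z , p⊆z , z⊆q , ∣q∣≡ = inside ∷ z , in⊆in p⊆z , s⊆s z⊆q , cong suc ∣q∣≡
facet-between {p = outside ∷ p} {outside ∷ q} p⊆q ∣p∣<∣q∣
  with facet-between (drop-∷-⊆ p⊆q) ∣p∣<∣q∣
... | z , p⊆z , z⊆q , ∣q∣≡ = outside ∷ z , s⊆s p⊆z , s⊆s z⊆q , ∣q∣≡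

1≤∣p∣⇒Nonempty : ∀ {n} {p : Subset n} → 1 ℕ.≤ ∣ p ∣ → Nonempty p
1≤∣p∣⇒Nonempty {p = inside ∷ p} _ = Fin.zero , here
1≤∣p∣⇒Nonempty {p = outside ∷ p} 1≤∣p∣ with 1≤∣p∣⇒Nonempty 1≤∣p∣
... | i , i∈p = Fin.suc i , there i∈p

==-refl : ∀ {n} (x : Subset n) → x == x ≡ true
==-refl x = trans (isYes≗does (x ≟ˢ x)) (dec-true (x ≟ˢ x) refl)

≢⇒==-false : ∀ {n} {x y : Subset n} → x ≢ y → x == y ≡ false
≢⇒==-false {x = x} {y} x≢y = trans (isYes≗does (x ≟ˢ y)) (dec-false (x ≟ˢ y) x≢y)

allSubsets-complete : ∀ {n} (x : Subset n) → x ∈ allSubsets n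
allSubsets-complete [] = here refl
allSubsets-complete {suc n} (inside ∷ x) = ∈-++⁺ˡ (∈-map⁺ (inside ∷_) (allSubsets-complete x))
allSubsets-complete {suc n} (outside ∷ x) =
  ∈-++⁺ʳ (map (inside ∷_) (allSubsets n)) (∈-map⁺ (outside ∷_) (allSubsets-complete x))

allSubsets-unique : ∀ n → Unique (allSubsets n)
allSubsets-unique zero = All.[] AllPairs.∷ AllPairs.[]
allSubsets-unique (suc n) =
  Unique.++⁺ (Unique.map⁺ ∷-injectiveʳ (allSubsets-unique n))
             (Unique.map⁺ ∷-injectiveʳ (allSubsets-unique n))
             disjoint
  where
  ∷-injectiveʳ : ∀ {b} {x y : Subset n} → b ∷ x ≡ b ∷ y → x ≡ y
  ∷-injectiveʳ refl = refl
  disjoint : ∀ {x} → x ∈ map (inside ∷_) (allSubsets n) × x ∈ map (outside ∷_) (allSubsets n) →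
             ⊥
  disjoint (x∈ᵢ , x∈ₒ) with ∈-map⁻ (inside ∷_) x∈ᵢ | ∈-map⁻ (outside ∷_) x∈ₒ
  ... | _ , _ , refl | _ , _ , ()

module _ (O : TotalOrder 0ℓ 0ℓ 0ℓ) where
  open TotalOrder O using () renaming (Carrier to B; _≤_ to _≤ₒ_)
  open import Data.List.Extrema O using (argmax; argmax-all; f[xs]≤f[argmax])

  maximum-on : ∀ {n} (f : Subset n → B) {P : Pred (Subset n) 0ℓ} → Decidable P →
               ∀ {y} → P y → ∃ λ v → P v × (∀ x → P x → f x ≤ₒ f v)
  maximum-on {n} f P? {y} Py =
    v , argmax-all f Py (all-filter P? (allSubsets n)) ,
    λ x Px → All.lookup (f[xs]≤f[argmax] y candidates) (∈-filter⁺ P? (allSubsets-complete x) Px)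
    where
    candidates = filter P? (allSubsets n)
    v = argmax f y candidates

pairs-∈ : ∀ {A : Set} {a b : A} xs → (a , b) ∈ pairs xs → a ∈ xs × b ∈ xs
pairs-∈ (x ∷ xs) ab∈ with ∈-++⁻ (map (x ,_) xs) ab∈
... | inj₁ ab∈row with ∈-map⁻ (x ,_) ab∈row
...   | b , b∈xs , refl = here refl , there b∈xs
pairs-∈ (x ∷ xs) ab∈ | inj₂ ab∈rest =
  let a∈ , b∈ = pairs-∈ xs ab∈rest in there a∈ , there b∈

pairs-unique : ∀ {A : Set} {xs : List A} → Unique xs → Unique (pairs xs)
pairs-unique AllPairs.[] = AllPairs.[]
pairs-unique {xs = x ∷ xs} u@(_ AllPairs.∷ uxs) =
  Unique.++⁺ (Unique.map⁺ (λ { refl → refl }) uxs) (pairs-unique uxs) disjoint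
  where
  disjoint : ∀ {p} → p ∈ map (x ,_) xs × p ∈ pairs xs → ⊥
  disjoint (p∈row , p∈rest) with ∈-map⁻ (x ,_) p∈row
  ... | _ , _ , refl = Unique.Unique[x∷xs]⇒x∉xs u (proj₁ (pairs-∈ xs p∈rest))

pairs-head : ∀ {A : Set} {x w : A} {xs} → Unique (x ∷ xs) → w ∈ xs →
             (x , w) ∈ pairs (x ∷ xs) × (w , x) ∉ pairs (x ∷ xs)
pairs-head {x = x} {xs = xs} u w∈xs = ∈-++⁺ˡ (∈-map⁺ (x ,_) w∈xs) , wx∉
  where
  wx∉ : (_ , x) ∉ pairs (x ∷ xs)
  wx∉ wx∈ with ∈-++⁻ (map (x ,_) xs) wx∈
  ... | inj₁ wx∈row with ∈-map⁻ (x ,_) wx∈row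
  ...   | _ , x∈xs , refl = Unique.Unique[x∷xs]⇒x∉xs u x∈xs
  wx∉ wx∈ | inj₂ wx∈rest = Unique.Unique[x∷xs]⇒x∉xs u (proj₂ (pairs-∈ xs wx∈rest))

pairs-tail : ∀ {A : Set} {x a b : A} {xs} → Unique (x ∷ xs) → a ∈ xs →
             (a , b) ∈ pairs (x ∷ xs) → (a , b) ∈ pairs xs
pairs-tail {x = x} {xs = xs} u a∈xs ab∈ with ∈-++⁻ (map (x ,_) xs) ab∈
... | inj₁ ab∈row with ∈-map⁻ (x ,_) ab∈row
...   | _ , _ , refl = contradiction a∈xs (Unique.Unique[x∷xs]⇒x∉xs u)
pairs-tail _ _ _ | inj₂ ab∈rest = ab∈rest

pairs-orientation : ∀ {A : Set} {v w : A} {xs} → Unique xs → v ∈ xs → w ∈ xs → v ≢ w →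
  ((v , w) ∈ pairs xs × (w , v) ∉ pairs xs) ⊎ ((w , v) ∈ pairs xs × (v , w) ∉ pairs xs)
pairs-orientation u (here refl) (here refl) v≢w = contradiction refl v≢w
pairs-orientation u (here refl) (there w∈xs) _ = inj₁ (pairs-head u w∈xs)
pairs-orientation u (there v∈xs) (here refl) _ = inj₂ (pairs-head u v∈xs)
pairs-orientation u@(_ AllPairs.∷ uxs) (there v∈xs) (there w∈xs) v≢w
  with pairs-orientation uxs v∈xs w∈xs v≢w
... | inj₁ (vw∈ , wv∉) = inj₁ (∈-++⁺ʳ _ vw∈ , wv∉ ∘ pairs-tail u w∈xs)
... | inj₂ (wv∈ , vw∉) = inj₂ (∈-++⁺ʳ _ wv∈ , vw∉ ∘ pairs-tail u v∈xs)

module Sum (CM : CommutativeMonoid 0ℓ 0ℓ) where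
  open CommutativeMonoid CM
    using (_≈_; _∙_; ε; ∙-cong; assoc; identityˡ; setoid; commutativeSemigroup)
    renaming (Carrier to C)
  private module CM = CommutativeMonoid CM
  open import Relation.Binary.Reasoning.Setoid setoid
  open import Algebra.Properties.CommutativeSemigroup commutativeSemigroup using (xy∙z≈xz∙y)

  ∑ : {A : Set} → (A → C) → List A → C
  ∑ f xs = foldr _∙_ ε (map f xs)

  ∑-cong : ∀ {A : Set} {f g : A → C} xs → (∀ {x} → x ∈ xs → f x ≈ g x) → ∑ f xs ≈ ∑ g xs
  ∑-cong [] _ = CM.refl
  ∑-cong (x ∷ xs) f≈g = ∙-cong (f≈g (here refl)) (∑-cong xs (f≈g ∘ there))

  ∑-ε : ∀ {A : Set} {f : A → C} xs → (∀ x → f x ≈ ε) → ∑ f xs ≈ ε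
  ∑-ε [] _ = CM.refl
  ∑-ε (x ∷ xs) f≈ε = CM.trans (∙-cong (f≈ε x) (∑-ε xs f≈ε)) (identityˡ ε)

  ∑-update : ∀ {A : Set} {f g : A → C} {v c} xs → Unique xs → v ∈ xs →
             (∀ {x} → x ∈ xs → x ≢ v → f x ≈ g x) → f v ≈ g v ∙ c → ∑ f xs ≈ ∑ g xs ∙ c
  ∑-update {f = f} {g} {c = c} (x ∷ xs) (x≢xs AllPairs.∷ _) (here refl) f≈g fx≈ = begin
    f x ∙ ∑ f xs        ≈⟨ ∙-cong fx≈ (∑-cong xs λ y∈ → f≈g (there y∈) (≢-sym (All.lookup x≢xs y∈))) ⟩
    (g x ∙ c) ∙ ∑ g xs  ≈⟨ xy∙z≈xz∙y (g x) c (∑ g xs) ⟩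
    (g x ∙ ∑ g xs) ∙ c  ∎
  ∑-update {f = f} {g} {c = c} (x ∷ xs) (x≢xs AllPairs.∷ u) (there v∈) f≈g fv≈ = begin
    f x ∙ ∑ f xs        ≈⟨ ∙-cong (f≈g (here refl) (All.lookup x≢xs v∈))
                                  (∑-update xs u v∈ (f≈g ∘ there) fv≈) ⟩
    g x ∙ (∑ g xs ∙ c)  ≈⟨ CM.sym (assoc (g x) (∑ g xs) c) ⟩
    (g x ∙ ∑ g xs) ∙ c  ∎

  ∑⟨_⟩ : ∀ {n} → (Subset n → Bool) → (Subset n → C) → C
  ∑⟨ V ⟩ f = ∑ (λ x → if V x then f x else ε) (allSubsets _)

  ∑⟨⟩-cong : ∀ {n} {V W : Subset n → Bool} (f : Subset n → C) →
             (∀ x → V x ≡ W x) → ∑⟨ V ⟩ f ≈ ∑⟨ W ⟩ f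
  ∑⟨⟩-cong f V≡W =
    ∑-cong (allSubsets _) (λ {x} _ → CM.reflexive (cong (λ b → if b then f x else ε) (V≡W x)))

  ∑⟨⟩-remove : ∀ {n} {V W : Subset n → Bool} {v} (f : Subset n → C) →
               V v ≡ true → W v ≡ false → (∀ x → x ≢ v → V x ≡ W x) →
               ∑⟨ V ⟩ f ≈ ∑⟨ W ⟩ f ∙ f v
  ∑⟨⟩-remove {n} {V} {W} {v} f Vv Wv V≡W =
    ∑-update (allSubsets n) (allSubsets-unique n) (allSubsets-complete v)
      (λ {x} _ x≢v → CM.reflexive (cong (λ b → if b then f x else ε) (V≡W x x≢v))) at-v
    where
    at-v : (if V v then f v else ε) ≈ (if W v then f v else ε) ∙ f v
    at-v rewrite Vv | Wv = CM.sym (identityˡ (f v))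

module ℤSum = Sum ℤP.+-0-commutativeMonoid
module ℕSum = Sum ℕP.+-0-commutativeMonoid

module _ {n} (Y : Graph n) (v w : Subset n) where

  removePair-V : ∀ {x} → x ≢ v → V (removePair Y v w) x ≡ V Y x
  removePair-V {x} x≢v =
    trans (cong (λ b → V Y x ∧ not b) (≢⇒==-false x≢v)) (∧-identityʳ (V Y x))

  removePair-V-removed : V (removePair Y v w) v ≡ false
  removePair-V-removed = trans (cong (λ b → V Y v ∧ not b) (==-refl v)) (∧-zeroʳ (V Y v))

  removePair-E-removed : E (removePair Y v w) v w ≡ false × E (removePair Y v w) w v ≡ false
  removePair-E-removed rewrite ==-refl v | ==-refl w =
    ∧-zeroʳ (E Y v w) ,
    trans (cong (λ b → E Y w v ∧ not b) (∨-zeroʳ (w == v ∧ v == w))) (∧-zeroʳ (E Y w v))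

  removePair-V⊆ : ∀ {x} → V (removePair Y v w) x ≡ true → V Y x ≡ true
  removePair-V⊆ {x} = ∧-conicalˡ (V Y x) _

  removePair-V-≢ : ∀ {x} → V (removePair Y v w) x ≡ true → x ≢ v
  removePair-V-≢ x∈Y′ refl = contradiction (trans (sym x∈Y′) removePair-V-removed) λ ()

  removePair-E⊆ : ∀ {x y} → E (removePair Y v w) x y ≡ true → E Y x y ≡ true
  removePair-E⊆ {x} {y} = ∧-conicalˡ (E Y x y) _

  removePair-E-cases : ∀ x y →
    (x ≡ v × y ≡ w) ⊎ (x ≡ w × y ≡ v) ⊎ E (removePair Y v w) x y ≡ E Y x y
  removePair-E-cases x y with x ≟ˢ v | y ≟ˢ w | x ≟ˢ w | y ≟ˢ v
  ... | yes x≡v | yes y≡w | _       | _       = inj₁ (x≡v , y≡w)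
  ... | _       | _       | yes x≡w | yes y≡v = inj₂ (inj₁ (x≡w , y≡v))
  ... | yes _   | no _    | yes _   | no _    = inj₂ (inj₂ (∧-identityʳ _))
  ... | yes _   | no _    | no _    | _       = inj₂ (inj₂ (∧-identityʳ _))
  ... | no _    | _       | yes _   | no _    = inj₂ (inj₂ (∧-identityʳ _))
  ... | no _    | _       | no _    | _       = inj₂ (inj₂ (∧-identityʳ _))

removePair-E-sym : ∀ {n} (Y : Graph n) v w → (∀ x y → E Y x y ≡ E Y y x) →
                   ∀ x y → E (removePair Y v w) x y ≡ E (removePair Y v w) y x
removePair-E-sym Y v w E-sym x y = cong₂ (λ b c → b ∧ not c) (E-sym x y) removed-sym
  where
  removed-sym :
    ((x == v ∧ y == w) ∨ (x == w ∧ y == v)) ≡ ((y == v ∧ x == w) ∨ (y == w ∧ x == v))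
  removed-sym = trans (cong₂ _∨_ (∧-comm (x == v) (y == w)) (∧-comm (x == w) (y == v)))
                      (∨-comm (y == w ∧ x == v) (y == v ∧ x == w))

edgeWeight : ∀ {n} → (Subset n → ℤ) → Graph n → Subset n × Subset n → ℤ
edgeWeight F Y (x , y) = if E Y x y then F (x ∩ y) else 0ℤ

weight-edgeless : ∀ {n} (F : Subset n → ℤ) (Y : Graph n) →
                  (∀ x y → E Y x y ≡ false) → weight F Y ≡ 0ℤ
weight-edgeless {n} F Y noEdge =
  ℤSum.∑-ε {f = edgeWeight F Y} (pairs (allSubsets n))
    (λ (x , y) → cong (λ b → if b then F (x ∩ y) else 0ℤ) (noEdge x y))

module _ {n} (F : Subset n → ℤ) (Y : Graph n) {v w : Subset n}
         (Evw : E Y v w ≡ true) (Ewv : E Y w v ≡ true) where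

  private
    Y′ = removePair Y v w

    unchanged : ∀ {p} → p ≢ (v , w) → p ≢ (w , v) → edgeWeight F Y p ≡ edgeWeight F Y′ p
    unchanged {x , y} p≢vw p≢wv with removePair-E-cases Y v w x y
    ... | inj₁ (refl , refl)        = contradiction refl p≢vw
    ... | inj₂ (inj₁ (refl , refl)) = contradiction refl p≢wv
    ... | inj₂ (inj₂ E′≡E)          = cong (λ b → if b then F (x ∩ y) else 0ℤ) (sym E′≡E)

    removed-vw : edgeWeight F Y (v , w) ≡ edgeWeight F Y′ (v , w) + F (v ∩ w)
    removed-vw rewrite proj₁ (removePair-E-removed Y v w) | Evw = sym (ℤP.+-identityˡ _)

    removed-wv : edgeWeight F Y (w , v) ≡ edgeWeight F Y′ (w , v) + F (v ∩ w)
    removed-wv rewrite proj₂ (removePair-E-removed Y v w) | Ewv =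
      trans (cong F (∩-comm w v)) (sym (ℤP.+-identityˡ _))

  weight-removePair : v ≢ w → weight F Y ≡ weight F Y′ + F (v ∩ w)
  weight-removePair v≢w
    with pairs-orientation (allSubsets-unique n) (allSubsets-complete v) (allSubsets-complete w) v≢w
  ... | inj₁ (vw∈ , wv∉) = ℤSum.∑-update _ (pairs-unique (allSubsets-unique n)) vw∈
                             (λ p∈ p≢vw → unchanged p≢vw λ { refl → wv∉ p∈ }) removed-vw
  ... | inj₂ (wv∈ , vw∉) = ℤSum.∑-update _ (pairs-unique (allSubsets-unique n)) wv∈
                             (λ p∈ p≢wv → unchanged (λ { refl → vw∉ p∈ }) p≢wv) removed-wv

path-head : ∀ {n} {S : SimplexSet n} {R a s} → PathBy S R a s → S a
path-head [ Sa ] = Sa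
path-head (Sa ∷⟨ _ ⟩ _) = Sa

module MorseStack {n} {d : ℕ} {M : Subset n → Bool} {F : Subset n → ℤ}
  (1≤d : 1 ℕ.≤ d)
  (M-closed : ∀ x y → y ∈ᶜ M → Nonempty x → x ⊆ y → x ∈ᶜ M)
  (M-pure : ∀ x → IsFacetOf (_∈ᶜ M) x → ∣ x ∣ ≡ suc d)
  (M-cofaces : ∀ x → x ∈ᶜ M → ∣ x ∣ ≡ d →
     Σ (Subset n) λ y₁ → Σ (Subset n) λ y₂ →
       y₁ ≢ y₂ × IsDFace d M y₁ × x ⊆ y₁ × IsDFace d M y₂ × x ⊆ y₂ ×
       (∀ y → IsDFace d M y → x ⊆ y → y ≡ y₁ ⊎ y ≡ y₂))
  (morse : IsMorseStack M F)
  where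

  private
    F-stack = proj₁ morse

  flat-pair-unique↑ : ∀ {z a b} → IsFlatPair M F z a → IsFlatPair M F z b → a ≡ b
  flat-pair-unique↑ {z} fa fb = proj₂ (proj₂ morse z _ _ _ _ fa fb (inj₁ refl) (inj₁ refl))

  flat-pair-unique↓ : ∀ {a z z′} → IsFlatPair M F z a → IsFlatPair M F z′ a → z ≡ z′
  flat-pair-unique↓ {a} fa fb = proj₁ (proj₂ morse a _ _ _ _ fa fb (inj₂ refl) (inj₂ refl))

  face⊆d-face : ∀ {y} → y ∈ᶜ M → ∃ λ z → IsDFace d M z × y ⊆ z
  face⊆d-face {y} y∈M with maximum-on ℕP.≤-totalOrder ∣_∣ P? (y∈M , ⊆-refl)
    where
    P? : ∀ z → Dec (z ∈ᶜ M × y ⊆ z)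
    P? z = (M z Bool.≟ true) ×-dec (y ⊆? z)
  ... | z , (z∈M , y⊆z) , z-max = z , (z∈M , M-pure z (z∈M , z-facet)) , y⊆z
    where
    z-facet : ∀ z′ → z′ ∈ᶜ M → z ⊆ z′ → z′ ≡ z
    z-facet z′ z′∈M z⊆z′ =
      sym (p⊆q∧∣q∣≤∣p∣⇒p≡q z⊆z′ (z-max z′ (z′∈M , ⊆-trans y⊆z z⊆z′)))

  d-face-maximal : ∀ {x y} → IsDFace d M x → y ∈ᶜ M → x ⊆ y → x ≡ y
  d-face-maximal {x} {y} (_ , ∣x∣≡) y∈M x⊆y with face⊆d-face y∈M
  ... | z , (_ , ∣z∣≡) , y⊆z =
    p⊆q∧∣q∣≤∣p∣⇒p≡q x⊆y
      (subst (∣ y ∣ ℕ.≤_) (trans ∣z∣≡ (sym ∣x∣≡)) (p⊆q⇒∣p∣≤∣q∣ y⊆z))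

  other-d-face : ∀ {z v} → z ∈ᶜ M → ∣ z ∣ ≡ d → IsDFace d M v → z ⊆ v →
                 ∃ λ p → IsDFace d M p × z ⊆ p × p ≢ v
  other-d-face {z} {v} z∈M ∣z∣≡d v-face z⊆v with M-cofaces z z∈M ∣z∣≡d
  ... | y₁ , y₂ , y₁≢y₂ , y₁-face , z⊆y₁ , y₂-face , z⊆y₂ , only with only v v-face z⊆v
  ...   | inj₁ refl = y₂ , y₂-face , z⊆y₂ , y₁≢y₂ ∘ sym
  ...   | inj₂ refl = y₁ , y₁-face , z⊆y₁ , y₁≢y₂

  third-d-face : ∀ {z a b c} → z ∈ᶜ M → ∣ z ∣ ≡ d →
                 IsDFace d M a → z ⊆ a → IsDFace d M b → z ⊆ b → IsDFace d M c → z ⊆ c →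
                 b ≢ a → c ≢ a → b ≡ c
  third-d-face {z} z∈M ∣z∣≡d a-face z⊆a b-face z⊆b c-face z⊆c b≢a c≢a
    with M-cofaces z z∈M ∣z∣≡d
  ... | _ , _ , y₁≢y₂ , _ , _ , _ , _ , only
    with only _ a-face z⊆a | only _ b-face z⊆b | only _ c-face z⊆c
  ... | inj₁ refl | inj₁ refl | _         = contradiction refl b≢a
  ... | inj₁ refl | inj₂ refl | inj₁ refl = contradiction refl c≢a
  ... | inj₁ refl | inj₂ refl | inj₂ refl = refl
  ... | inj₂ refl | inj₁ refl | inj₁ refl = refl
  ... | inj₂ refl | inj₁ refl | inj₂ refl = contradiction refl c≢a
  ... | inj₂ refl | inj₂ refl | _         = contradiction refl b≢a

  covering-of-d-face : ∀ {z y} → z ∈ᶜ M → ∣ z ∣ ≡ d → IsDFace d M y → z ⊆ y →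
                       IsCoveringPair M z y
  covering-of-d-face z∈M ∣z∣≡d (y∈M , ∣y∣≡) z⊆y =
    z∈M , y∈M , z⊆y , trans ∣y∣≡ (cong suc (sym ∣z∣≡d))

  d-face-∩ : ∀ {v p z} → IsDFace d M v → IsDFace d M p → p ≢ v →
             z ⊆ v → z ⊆ p → ∣ z ∣ ≡ d → z ≡ v ∩ p
  d-face-∩ {v} {p} {z} v-face p-face p≢v z⊆v z⊆p ∣z∣≡d =
    p⊆q∧∣q∣≤∣p∣⇒p≡q (λ i∈z → x∈p∩q⁺ (z⊆v i∈z , z⊆p i∈z))
                    (subst (∣ v ∩ p ∣ ℕ.≤_) (sym ∣z∣≡d) ∣v∩p∣≤d)
    where
    ∣v∩p∣≤d : ∣ v ∩ p ∣ ℕ.≤ d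
    ∣v∩p∣≤d with suc d ℕP.≤? ∣ v ∩ p ∣
    ... | no  ∣v∩p∣≯d = ℕP.≤-pred (ℕP.≰⇒> ∣v∩p∣≯d)
    ... | yes ∣v∩p∣>d = contradiction (sym (d-face-maximal v-face (proj₁ p-face) v⊆p)) p≢v
      where
      v∩p≡v : v ∩ p ≡ v
      v∩p≡v = p⊆q∧∣q∣≤∣p∣⇒p≡q (p∩q⊆p v p)
                (subst (ℕ._≤ ∣ v ∩ p ∣) (sym (proj₂ v-face)) ∣v∩p∣>d)
      v⊆p : v ⊆ p
      v⊆p = p∩q⊆q v p ∘ subst (λ s → _ ∈ˢ s) (sym v∩p≡v)

  subface-∈M : ∀ {x z} → x ∈ᶜ M → z ⊆ x → ∣ z ∣ ≡ d → z ∈ᶜ M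
  subface-∈M x∈M z⊆x ∣z∣≡d =
    M-closed _ _ x∈M (1≤∣p∣⇒Nonempty (subst (1 ℕ.≤_) (sym ∣z∣≡d) 1≤d)) z⊆x

  codim1-face-between : ∀ {x y} → IsDFace d M x → y ⊆ x → ∣ y ∣ ≢ ∣ x ∣ →
                        ∃ λ z → z ∈ᶜ M × y ⊆ z × z ⊆ x × ∣ z ∣ ≡ d
  codim1-face-between (x∈M , ∣x∣≡) y⊆x ∣y∣≢∣x∣
    with facet-between y⊆x (ℕP.≤∧≢⇒< (p⊆q⇒∣p∣≤∣q∣ y⊆x) ∣y∣≢∣x∣)
  ... | z , y⊆z , z⊆x , ∣x∣≡1+∣z∣ =
    z , subface-∈M x∈M z⊆x ∣z∣≡d , y⊆z , z⊆x , ∣z∣≡d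
    where
    ∣z∣≡d = ℕP.suc-injective (trans (sym ∣x∣≡1+∣z∣) ∣x∣≡)

  facet-edge-sym : ∀ {x y} → IsFacetEdge d M x y → IsFacetEdge d M y x
  facet-edge-sym {x} {y} (x-face , y-face , x∩y∈M , ∣x∩y∣≡d) rewrite ∩-comm x y =
    y-face , x-face , x∩y∈M , ∣x∩y∣≡d

  facet-edge-≢ : ∀ {x y} → IsFacetEdge d M x y → x ≢ y
  facet-edge-≢ {x} ((_ , ∣x∣≡) , _ , _ , ∣x∩x∣≡d) refl rewrite ∩-idem x =
    ℕP.1+n≢n (trans (sym ∣x∣≡) ∣x∩x∣≡d)

  Descends : Subset n → Subset n → Set
  Descends x p = IsFacetEdge d M x p × IsDifferentialPair M F p (x ∩ p) × IsFlatPair M F (x ∩ p) x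

  IsWatershedEdge : Subset n → Subset n → Set
  IsWatershedEdge x y = IsFacetEdge d M x y ×
    ((IsDifferentialPair M F x (x ∩ y) × IsFlatPair M F (x ∩ y) y) ⊎
     (IsDifferentialPair M F y (x ∩ y) × IsFlatPair M F (x ∩ y) x))

  descends⇒watershedEdge : ∀ {x y} → Descends x y → IsWatershedEdge x y
  descends⇒watershedEdge (edge , diff , flat) = edge , inj₂ (diff , flat)

  descends⇒watershedEdge′ : ∀ {x y} → Descends y x → IsWatershedEdge x y
  descends⇒watershedEdge′ {x} {y} (edge , diff-flat) =
    facet-edge-sym edge ,
    inj₁ (subst (λ s → IsDifferentialPair M F x s × IsFlatPair M F s y) (∩-comm y x) diff-flat)

  watershedEdge⇒descends : ∀ {x y} → IsWatershedEdge x y → Descends x y ⊎ Descends y x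
  watershedEdge⇒descends (edge , inj₂ (diff , flat)) = inj₁ (edge , diff , flat)
  watershedEdge⇒descends {x} {y} (edge , inj₁ diff-flat) =
    inj₂ (facet-edge-sym edge ,
          subst (λ s → IsDifferentialPair M F x s × IsFlatPair M F s y) (∩-comm x y) diff-flat)

  watershedEdge-sym : ∀ {x y} → IsWatershedEdge x y → IsWatershedEdge y x
  watershedEdge-sym w with watershedEdge⇒descends w
  ... | inj₁ x↘y = descends⇒watershedEdge′ x↘y
  ... | inj₂ y↘x = descends⇒watershedEdge y↘x

  flat-edge⇒descends : ∀ {x p} → IsFacetEdge d M x p → F (x ∩ p) ≡ F x → Descends x p
  flat-edge⇒descends {x} {p} edge@(x-face , p-face , x∩p∈M , ∣x∩p∣≡d) flat =
    edge , (covering-p , ℤP.≤∧≢⇒< (F-stack _ _ x∩p∈M (proj₁ p-face) (p∩q⊆q x p)) p-not-flat) ,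
    (covering-of-d-face x∩p∈M ∣x∩p∣≡d x-face (p∩q⊆p x p) , flat)
    where
    covering-p = covering-of-d-face x∩p∈M ∣x∩p∣≡d p-face (p∩q⊆q x p)
    -- a second flat pair on x ∩ p would contradict the Morse condition
    p-not-flat : F p ≢ F (x ∩ p)
    p-not-flat Fp≡ = facet-edge-≢ edge
      (flat-pair-unique↑ (covering-of-d-face x∩p∈M ∣x∩p∣≡d x-face (p∩q⊆p x p) , flat)
                         (covering-p , sym Fp≡))

  descends-< : ∀ {x p} → Descends x p → F p < F x
  descends-< (_ , (_ , Fp<) , (_ , flat)) = subst (F _ <_) flat Fp<

  descends-unique : ∀ {x p q} → Descends x p → Descends x q → p ≡ q
  descends-unique {x} {p} {q} x↘p@((x-face , p-face , x∩p∈M , ∣x∩p∣≡d) , _ , flat-p)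
                              x↘q@((_ , q-face , _ , _) , _ , flat-q) =
    third-d-face x∩p∈M ∣x∩p∣≡d x-face (p∩q⊆p x p) p-face (p∩q⊆q x p) q-face x∩p⊆q
                 (facet-edge-≢ (proj₁ x↘p) ∘ sym) (facet-edge-≢ (proj₁ x↘q) ∘ sym)
    where
    x∩p⊆q : x ∩ p ⊆ q
    x∩p⊆q = p∩q⊆q x q ∘ subst (λ s → _ ∈ˢ s) (flat-pair-unique↓ flat-p flat-q)

  -- Roots are the minima

  HasFlatFacet : Subset n → Set
  HasFlatFacet x = ∃ λ z → z ∈ᶜ M × z ⊆ x × ∣ z ∣ ≡ d × F z ≡ F x

  hasFlatFacet? : ∀ x → Dec (HasFlatFacet x)
  hasFlatFacet? x = anySubset? λ z →
    (M z Bool.≟ true) ×-dec (z ⊆? x) ×-dec (∣ z ∣ ℕ.≟ d) ×-dec (F z ℤ.≟ F x)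

  descends⇒hasFlatFacet : ∀ {x p} → Descends x p → HasFlatFacet x
  descends⇒hasFlatFacet {x} {p} ((_ , _ , x∩p∈M , ∣x∩p∣≡d) , _ , (_ , flat)) =
    x ∩ p , x∩p∈M , p∩q⊆p x p , ∣x∩p∣≡d , flat

  hasFlatFacet⇒descends : ∀ {x} → IsDFace d M x → HasFlatFacet x → ∃ (Descends x)
  hasFlatFacet⇒descends x-face (z , z∈M , z⊆x , ∣z∣≡d , Fz≡Fx)
    with other-d-face z∈M ∣z∣≡d x-face z⊆x
  ... | p , p-face , z⊆p , p≢x with d-face-∩ x-face p-face p≢x z⊆x z⊆p ∣z∣≡d
  ...   | refl = p , flat-edge⇒descends (x-face , p-face , z∈M , ∣z∣≡d) Fz≡Fx

  IsRoot : Subset n → Set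
  IsRoot x = IsDFace d M x × ¬ HasFlatFacet x

  isRoot? : ∀ x → Dec (IsRoot x)
  isRoot? x = ((M x Bool.≟ true) ×-dec (∣ x ∣ ℕ.≟ suc d)) ×-dec ¬? (hasFlatFacet? x)

  isRoot : Subset n → Bool
  isRoot x = does (isRoot? x)

  isRoot-sound : ∀ {x} → isRoot x ≡ true → IsRoot x
  isRoot-sound {x} = does-true⇒ (isRoot? x)

  non-root⇒descends : ∀ {x} → IsDFace d M x → isRoot x ≡ false → ∃ (Descends x)
  non-root⇒descends {x} x-face notRoot = from (hasFlatFacet? x)
    where
    from : Dec (HasFlatFacet x) → ∃ (Descends x)
    from (yes flat) = hasFlatFacet⇒descends x-face flat
    from (no ¬flat) = contradiction (trans (sym (dec-true (isRoot? x) (x-face , ¬flat))) notRoot) λ ()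

  descends⇒non-root : ∀ {x p} → Descends x p → isRoot x ≡ false
  descends⇒non-root {x} x↘p =
    dec-false (isRoot? x) (λ (_ , ¬flat) → ¬flat (descends⇒hasFlatFacet x↘p))

  Sublevel : ℤ → Subset n → Set
  Sublevel λ′ x = x ∈ᶜ M × F x ≤ λ′

  -- The other d-face p of z would join the minimum through z, and would then form a
  -- second flat pair with z.
  minimum-has-no-flat-facet : ∀ {λ′ A y z} → IsMinimumAt M F λ′ A → A y →
                              IsFlatPair M F z y → ∣ z ∣ ≡ d → ⊥
  minimum-has-no-flat-facet {y = y} {z} ((_ , A⊆S , A-component) , A≥λ) y∈A
                            flat-zy@((z∈M , y∈M , z⊆y , ∣y∣≡) , Fz≡Fy) ∣z∣≡d
    with other-d-face z∈M ∣z∣≡d (y∈M , trans ∣y∣≡ (cong suc ∣z∣≡d)) z⊆y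
  ... | p , p-face , z⊆p , p≢y = p≢y (sym (flat-pair-unique↑ flat-zy flat-zp))
    where
    Sy = A⊆S y y∈A
    Fp≤Fz = F-stack z p z∈M (proj₁ p-face) z⊆p
    Sz : Sublevel _ z
    Sz = z∈M , subst (_≤ _) (sym Fz≡Fy) (proj₂ Sy)
    Sp : Sublevel _ p
    Sp = proj₁ p-face , ℤP.≤-trans Fp≤Fz (proj₂ Sz)
    p∈A = Equivalence.from (A-component y p y∈A) (Sy ∷⟨ inj₂ z⊆y ⟩ (Sz ∷⟨ inj₁ z⊆p ⟩ [ Sp ]))
    flat-zp : IsFlatPair M F z p
    flat-zp = covering-of-d-face z∈M ∣z∣≡d p-face z⊆p ,
              ℤP.≤-antisym (ℤP.≤-trans (proj₂ Sz) (A≥λ p p∈A)) Fp≤Fz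

  -- If m lies strictly below a d-face z, the (d-1)-face between them is flat with z.
  minimum⊆d-faces : ∀ {λ′ A m} → IsMinimumAt M F λ′ A → A m → IsDFace d M m
  minimum⊆d-faces {m = m} minimum@((_ , A⊆S , A-component) , A≥λ) m∈A
    with ∣ m ∣ ℕ.≟ suc d | face⊆d-face (proj₁ (A⊆S m m∈A))
  ... | yes ∣m∣≡ | _ = proj₁ (A⊆S m m∈A) , ∣m∣≡
  ... | no  ∣m∣≢ | z , z-face@(z∈M , ∣z∣≡) , m⊆z
    with codim1-face-between z-face m⊆z (λ ∣m∣≡∣z∣ → ∣m∣≢ (trans ∣m∣≡∣z∣ ∣z∣≡))
  ... | z′ , z′∈M , m⊆z′ , z′⊆z , ∣z′∣≡d =
    ⊥-elim (minimum-has-no-flat-facet minimum z∈A flat ∣z′∣≡d)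
    where
    Sm = A⊆S m m∈A
    Fz≤Fz′ = F-stack z′ z z′∈M z∈M z′⊆z
    Fz′≤Fm = F-stack m z′ (proj₁ Sm) z′∈M m⊆z′
    z∈A = Equivalence.from (A-component m z m∈A)
            (Sm ∷⟨ inj₁ m⊆z ⟩ [ z∈M , ℤP.≤-trans Fz≤Fz′ (ℤP.≤-trans Fz′≤Fm (proj₂ Sm)) ])
    flat : IsFlatPair M F z′ z
    flat = covering-of-d-face z′∈M ∣z′∣≡d z-face z′⊆z ,
           ℤP.≤-antisym (ℤP.≤-trans Fz′≤Fm (ℤP.≤-trans (proj₂ Sm) (A≥λ z z∈A))) Fz≤Fz′

  InMin⇒IsRoot : ∀ {m} → InMin M F m → IsRoot m
  InMin⇒IsRoot {m} (_ , _ , minimum , m∈A) = m-face , ¬flat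
    where
    m-face = minimum⊆d-faces minimum m∈A
    ¬flat : ¬ HasFlatFacet m
    ¬flat (z , z∈M , z⊆m , ∣z∣≡d , Fz≡Fm) =
      minimum-has-no-flat-facet minimum m∈A
        (covering-of-d-face z∈M ∣z∣≡d m-face z⊆m , Fz≡Fm) ∣z∣≡d

  -- {x} is the component of x in the sublevel set at F x: a larger face is x itself, and a
  -- proper face of x at level ≤ F x would give a flat facet.
  IsRoot⇒InMin : ∀ {x} → IsRoot x → InMin M F x
  IsRoot⇒InMin {x} (x-face@(x∈M , _) , ¬flat) =
    F x , (_≡ x) ,
    (((x , refl) , (λ { _ refl → Sx }) , component) , (λ { _ refl → ℤP.≤-refl })) , refl
    where
    Sx : Sublevel (F x) x
    Sx = x∈M , ℤP.≤-refl
    isolated : ∀ {y} → Sublevel (F x) y → Comparable x y → y ≡ x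
    isolated (y∈M , _) (inj₁ x⊆y) = sym (d-face-maximal x-face y∈M x⊆y)
    isolated {y} (y∈M , Fy≤Fx) (inj₂ y⊆x) with ∣ y ∣ ℕ.≟ ∣ x ∣
    ... | yes ∣y∣≡∣x∣ = p⊆q∧∣q∣≤∣p∣⇒p≡q y⊆x (ℕP.≤-reflexive (sym ∣y∣≡∣x∣))
    ... | no  ∣y∣≢∣x∣ with codim1-face-between x-face y⊆x ∣y∣≢∣x∣
    ...   | z , z∈M , y⊆z , z⊆x , ∣z∣≡d = ⊥-elim (¬flat (z , z∈M , z⊆x , ∣z∣≡d , Fz≡Fx))
      where
      Fz≡Fx = ℤP.≤-antisym (ℤP.≤-trans (F-stack y z y∈M z∈M y⊆z) Fy≤Fx)
                           (F-stack z x z∈M x∈M z⊆x)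
    stays : ∀ {a s} → Path (Sublevel (F x)) a s → a ≡ x → s ≡ x
    stays [ _ ] a≡x = a≡x
    stays (_ ∷⟨ x~b ⟩ rest) refl = stays rest (isolated (path-head rest) x~b)
    component : ∀ a s → a ≡ x → (s ≡ x ⇔ Path (Sublevel (F x)) a s)
    component a s refl = mk⇔ (λ { refl → [ Sx ] }) (λ path → stays path refl)

  InMin⇔isRoot : ∀ {x} → InMin M F x ⇔ isRoot x ≡ true
  InMin⇔isRoot {x} = mk⇔ (dec-true (isRoot? x) ∘ InMin⇒IsRoot) (IsRoot⇒InMin ∘ isRoot-sound)

  -- A d-face of least altitude cannot descend anywhere.
  ∃-root : ∀ {y} → y ∈ᶜ M → ∃ IsRoot
  ∃-root y∈M with face⊆d-face y∈M
  ... | z , z-face , _ with maximum-on (Flip.totalOrder ℤP.≤-totalOrder) F d-face? z-face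
    where
    d-face? : ∀ x → Dec (IsDFace d M x)
    d-face? x = (M x Bool.≟ true) ×-dec (∣ x ∣ ℕ.≟ suc d)
  ... | v , v-face , v-lowest = v , v-face , ¬flat
    where
    ¬flat : ¬ HasFlatFacet v
    ¬flat flat with hasFlatFacet⇒descends v-face flat
    ... | p , v↘p@((_ , p-face , _) , _) = ℤP.<⇒≱ (descends-< v↘p) (v-lowest p p-face)

  -- The weight bound

  Φ : (Subset n → Bool) → ℤ
  Φ V = ℤSum.∑⟨ V ⟩ F

  -- Equality in forest-bound, which says weight F Y ≥ Φ (V Y) - Φ isRoot.
  IsTight : Graph n → Set
  IsTight Y = weight F Y + Φ isRoot ≡ Φ (V Y)

  EdgesInΥ : Graph n → Set
  EdgesInΥ Y = (∀ x y → E Y x y ≡ true → IsFacetEdge d M x y) × (∀ x y → E Y x y ≡ E Y y x)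

  Φ-removePair : ∀ Y {v} w → V Y v ≡ true → Φ (V Y) ≡ Φ (V (removePair Y v w)) + F v
  Φ-removePair Y w v∈Y =
    ℤSum.∑⟨⟩-remove F v∈Y (removePair-V-removed Y _ w) (λ x x≢v → sym (removePair-V Y _ w x≢v))

  Φ-roots : ∀ {V′} → (∀ x → V′ x ≡ true ⇔ InMin M F x) → Φ V′ ≡ Φ isRoot
  Φ-roots V′⇔InMin = ℤSum.∑⟨⟩-cong F (λ x → ≡true-ext (InMin⇔isRoot ⇔-∘ V′⇔InMin x))

  edgeless-tight : ∀ {Y} → (∀ x → V Y x ≡ true ⇔ InMin M F x) → (∀ x y → E Y x y ≡ false) →
                   IsTight Y
  edgeless-tight {Y} V⇔InMin no-edges = begin
    weight F Y + Φ isRoot  ≡⟨ cong (_+ Φ isRoot) (weight-edgeless F Y no-edges) ⟩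
    0ℤ + Φ isRoot          ≡⟨ ℤP.+-identityˡ (Φ isRoot) ⟩
    Φ isRoot               ≡⟨ sym (Φ-roots V⇔InMin) ⟩
    Φ (V Y)                ∎
    where open ≡-Reasoning

  IsDescending : Graph n → Set
  IsDescending Y = (∀ x y → E Y x y ≡ true → IsWatershedEdge x y) ×
                   (∀ x → V Y x ≡ true → isRoot x ≡ false → ∃ λ p → E Y x p ≡ true × Descends x p)

  module RemoveEdge (Y : Graph n) (v w : Subset n) (edges : EdgesInΥ Y) (vw∈Y : E Y v w ≡ true) where

    private
      Y′ = removePair Y v w
      vw-edge = proj₁ edges v w vw∈Y

    EdgesInΥ-removePair : EdgesInΥ Y′
    EdgesInΥ-removePair =
      (λ x y → proj₁ edges x y ∘ removePair-E⊆ Y v w) , removePair-E-sym Y v w (proj₂ edges)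

    F-below-edge : F v ≤ F (v ∩ w)
    F-below-edge =
      F-stack (v ∩ w) v (proj₁ (proj₂ (proj₂ vw-edge))) (proj₁ (proj₁ vw-edge)) (p∩q⊆p v w)

    weight-step : weight F Y + Φ isRoot ≡ (weight F Y′ + Φ isRoot) + F (v ∩ w)
    weight-step = begin
      weight F Y + Φ isRoot
        ≡⟨ cong (_+ Φ isRoot) (weight-removePair F Y vw∈Y wv∈Y (facet-edge-≢ vw-edge)) ⟩
      (weight F Y′ + F (v ∩ w)) + Φ isRoot
        ≡⟨ ℤ-comm.xy∙z≈xz∙y (weight F Y′) (F (v ∩ w)) (Φ isRoot) ⟩
      (weight F Y′ + Φ isRoot) + F (v ∩ w) ∎
      where
      open ≡-Reasoning
      wv∈Y = trans (sym (proj₂ edges v w)) vw∈Y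

    descending-step : IsDescending Y′ → Descends v w → IsDescending Y
    descending-step (edges′ , descents′) v↘w = edges-watershed , descents
      where
      edges-watershed : ∀ x y → E Y x y ≡ true → IsWatershedEdge x y
      edges-watershed x y xy∈Y with removePair-E-cases Y v w x y
      ... | inj₁ (refl , refl)        = descends⇒watershedEdge v↘w
      ... | inj₂ (inj₁ (refl , refl)) = descends⇒watershedEdge′ v↘w
      ... | inj₂ (inj₂ E′≡E)          = edges′ x y (trans E′≡E xy∈Y)
      descents : ∀ x → V Y x ≡ true → isRoot x ≡ false → ∃ λ p → E Y x p ≡ true × Descends x p
      descents x x∈Y non-root with x ≟ˢ v
      ... | yes refl = w , vw∈Y , v↘w
      ... | no  x≢v with descents′ x (trans (removePair-V Y v w x≢v) x∈Y) non-root
      ...   | p , xp∈Y′ , x↘p = p , removePair-E⊆ Y v w xp∈Y′ , x↘p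

  forest-bound : ∀ {Y} → RootedForest (InMin M F) Y → EdgesInΥ Y →
                 Φ (V Y) ≤ weight F Y + Φ isRoot
  forest-bound (base Y V⇔InMin no-edges) _ =
    ℤP.≤-reflexive (sym (edgeless-tight V⇔InMin no-edges))
  forest-bound (step Y v w (v∈Y , vw∈Y , _) _ forest′) edges = begin
    Φ (V Y)
      ≡⟨ Φ-removePair Y w v∈Y ⟩
    Φ (V (removePair Y v w)) + F v
      ≤⟨ ℤP.+-mono-≤ (forest-bound forest′ EdgesInΥ-removePair) F-below-edge ⟩
    (weight F (removePair Y v w) + Φ isRoot) + F (v ∩ w)
      ≡⟨ sym weight-step ⟩
    weight F Y + Φ isRoot ∎
    where
    open ℤP.≤-Reasoning
    open RemoveEdge Y v w edges vw∈Y

  tight⇒descending : ∀ {Y} → RootedForest (InMin M F) Y → EdgesInΥ Y → IsTight Y →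
                     IsDescending Y
  tight⇒descending (base Y V⇔InMin no-edges) _ _ =
    (λ x y xy∈Y → contradiction (trans (sym xy∈Y) (no-edges x y)) λ ()) ,
    (λ x x∈Y non-root → contradiction (trans (sym (x-root x x∈Y)) non-root) λ ())
    where
    x-root : ∀ x → V Y x ≡ true → isRoot x ≡ true
    x-root x = Equivalence.to InMin⇔isRoot ∘ Equivalence.to (V⇔InMin x)
  tight⇒descending (step Y v w (v∈Y , vw∈Y , _) _ forest′) edges tight =
    descending-step (tight⇒descending forest′ EdgesInΥ-removePair (sym (proj₁ split)))
                    (flat-edge⇒descends (proj₁ edges v w vw∈Y) (sym (proj₂ split)))
    where
    open RemoveEdge Y v w edges vw∈Y
    split : Φ (V (removePair Y v w)) ≡ weight F (removePair Y v w) + Φ isRoot × F v ≡ F (v ∩ w)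
    split = +-mono-≤-reflects-≡ (forest-bound forest′ EdgesInΥ-removePair) F-below-edge
              (trans (sym (Φ-removePair Y w v∈Y)) (trans (sym tight) weight-step))

  -- Peeling the watershed forest

  record IsWatershedSubgraph (Y : Graph n) : Set where
    field
      vertex-face    : ∀ {x} → V Y x ≡ true → IsDFace d M x
      roots⊆         : ∀ {x} → isRoot x ≡ true → V Y x ≡ true
      edge⇔          : ∀ x y → E Y x y ≡ true ⇔ (V Y x ≡ true × V Y y ≡ true × IsWatershedEdge x y)
      descent-closed : ∀ {x p} → V Y x ≡ true → Descends x p → V Y p ≡ true

    edges-in-Υ : EdgesInΥ Y
    edges-in-Υ = (λ x y xy∈Y → proj₁ (proj₂ (proj₂ (Equivalence.to (edge⇔ x y) xy∈Y)))) ,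
                 (λ x y → ≡true-ext (mk⇔ (swap-edge x y) (swap-edge y x)))
      where
      swap-edge : ∀ x y → E Y x y ≡ true → E Y y x ≡ true
      swap-edge x y xy∈Y with Equivalence.to (edge⇔ x y) xy∈Y
      ... | x∈Y , y∈Y , xy = Equivalence.from (edge⇔ y x) (y∈Y , x∈Y , watershedEdge-sym xy)

  open IsWatershedSubgraph

  NonRootVertex : Graph n → Subset n → Set
  NonRootVertex Y x = V Y x ≡ true × isRoot x ≡ false

  nonRootVertex? : ∀ Y x → Dec (NonRootVertex Y x)
  nonRootVertex? Y x = (V Y x Bool.≟ true) ×-dec (isRoot x Bool.≟ false)

  count : (Subset n → Bool) → ℕ
  count V = ℕSum.∑⟨ V ⟩ (λ _ → 1)

  -- Removing a non-root vertex v of maximal altitude, together with the edge to the face it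
  -- descends to, keeps a watershed subgraph: nothing descends into v.
  module Peel {Y : Graph n} (W : IsWatershedSubgraph Y) {v p : Subset n}
              (v∈Y : V Y v ≡ true) (v↘p : Descends v p)
              (v-highest : ∀ x → NonRootVertex Y x → F x ≤ F v) where

    private
      Y′ = removePair Y v p
      p∈Y = descent-closed W v∈Y v↘p
      vp∈Y = Equivalence.from (edge⇔ W v p) (v∈Y , p∈Y , descends⇒watershedEdge v↘p)

    nothing-descends-to-v : ∀ {x} → V Y x ≡ true → ¬ Descends x v
    nothing-descends-to-v x∈Y x↘v =
      ℤP.<⇒≱ (descends-< x↘v) (v-highest _ (x∈Y , descends⇒non-root x↘v))

    free : IsFreePair Y v p
    free = v∈Y , vp∈Y , only-p
      where
      only-p : ∀ u → E Y v u ≡ true → u ≡ p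
      only-p u vu∈Y with Equivalence.to (edge⇔ W v u) vu∈Y
      ... | _ , u∈Y , vu with watershedEdge⇒descends vu
      ...   | inj₁ v↘u = descends-unique v↘u v↘p
      ...   | inj₂ u↘v = contradiction u↘v (nothing-descends-to-v u∈Y)

    count-decreases : count (V Y′) ℕ.< count (V Y)
    count-decreases = subst (count (V Y′) ℕ.<_)
      (sym (ℕSum.∑⟨⟩-remove (λ _ → 1) v∈Y (removePair-V-removed Y v p)
                             (λ x x≢v → sym (removePair-V Y v p x≢v))))
      (ℕP.m<m+n (count (V Y′)) (ℕ.s≤s ℕ.z≤n))

    tight-step : IsTight Y′ → IsTight Y
    tight-step tight′ = begin
      weight F Y + Φ isRoot                ≡⟨ weight-step ⟩
      (weight F Y′ + Φ isRoot) + F (v ∩ p) ≡⟨ cong₂ _+_ tight′ v∩p-flat ⟩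
      Φ (V Y′) + F v                       ≡⟨ sym (Φ-removePair Y p v∈Y) ⟩
      Φ (V Y)                              ∎
      where
      open ≡-Reasoning
      open RemoveEdge Y v p (edges-in-Υ W) vp∈Y
      v∩p-flat : F (v ∩ p) ≡ F v
      v∩p-flat = let _ , _ , _ , flat = v↘p in flat

    roots-kept : ∀ x → InMin M F x → V Y′ x ≡ true
    roots-kept x x∈min = trans (removePair-V Y v p x≢v) (roots⊆ W x-root)
      where
      x-root = Equivalence.to InMin⇔isRoot x∈min
      x≢v : x ≢ v
      x≢v refl = contradiction (trans (sym x-root) (descends⇒non-root v↘p)) λ ()

    W′ : IsWatershedSubgraph Y′
    W′ = record
      { vertex-face    = vertex-face W ∘ removePair-V⊆ Y v p
      ; roots⊆         = λ x-root → roots-kept _ (Equivalence.from InMin⇔isRoot x-root)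
      ; edge⇔          = λ x y → mk⇔ (to x y) (from x y)
      ; descent-closed = descent-closed′
      }
      where
      descent-closed′ : ∀ {x q} → V Y′ x ≡ true → Descends x q → V Y′ q ≡ true
      descent-closed′ x∈Y′ x↘q = trans (removePair-V Y v p q≢v) (descent-closed W x∈Y x↘q)
        where
        x∈Y = removePair-V⊆ Y v p x∈Y′
        q≢v : _ ≢ v
        q≢v refl = nothing-descends-to-v x∈Y x↘q

      edge-avoids-v : ∀ {x y} → E Y′ x y ≡ true → x ≢ v
      edge-avoids-v xy∈Y′ refl with proj₂ (proj₂ free) _ (removePair-E⊆ Y v p xy∈Y′)
      ... | refl = contradiction (trans (sym xy∈Y′) (proj₁ (removePair-E-removed Y v p))) λ ()

      to : ∀ x y → E Y′ x y ≡ true → V Y′ x ≡ true × V Y′ y ≡ true × IsWatershedEdge x y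
      to x y xy∈Y′ with Equivalence.to (edge⇔ W x y) (removePair-E⊆ Y v p xy∈Y′)
      ... | x∈Y , y∈Y , xy =
        trans (removePair-V Y v p (edge-avoids-v xy∈Y′)) x∈Y ,
        trans (removePair-V Y v p (edge-avoids-v yx∈Y′)) y∈Y , xy
        where
        yx∈Y′ = trans (removePair-E-sym Y v p (proj₂ (edges-in-Υ W)) y x) xy∈Y′

      from : ∀ x y → V Y′ x ≡ true × V Y′ y ≡ true × IsWatershedEdge x y → E Y′ x y ≡ true
      from x y (x∈Y′ , y∈Y′ , xy) with removePair-E-cases Y v p x y
      ... | inj₁ (refl , _)        = contradiction refl (removePair-V-≢ Y v p x∈Y′)
      ... | inj₂ (inj₁ (_ , refl)) = contradiction refl (removePair-V-≢ Y v p y∈Y′)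
      ... | inj₂ (inj₂ E′≡E)       =
        trans E′≡E (Equivalence.from (edge⇔ W x y)
                                     (removePair-V⊆ Y v p x∈Y′ , removePair-V⊆ Y v p y∈Y′ , xy))

  all-roots-forest : ∀ {Y} → IsWatershedSubgraph Y → (∀ x → V Y x ≡ true → isRoot x ≡ true) →
                     RootedForest (InMin M F) Y × IsTight Y
  all-roots-forest {Y} W only-roots = base Y V⇔InMin no-edges , edgeless-tight V⇔InMin no-edges
    where
    V⇔InMin : ∀ x → V Y x ≡ true ⇔ InMin M F x
    V⇔InMin x = mk⇔ (Equivalence.from InMin⇔isRoot ∘ only-roots x)
                    (roots⊆ W ∘ Equivalence.to InMin⇔isRoot)
    no-edges : ∀ x y → E Y x y ≡ false
    no-edges x y = ¬-not λ xy∈Y → edge-to-root (Equivalence.to (edge⇔ W x y) xy∈Y)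
      where
      edge-to-root : ¬ (V Y x ≡ true × V Y y ≡ true × IsWatershedEdge x y)
      edge-to-root (x∈Y , y∈Y , xy) with watershedEdge⇒descends xy
      ... | inj₁ x↘y = contradiction (trans (sym (only-roots x x∈Y)) (descends⇒non-root x↘y)) λ ()
      ... | inj₂ y↘x = contradiction (trans (sym (only-roots y y∈Y)) (descends⇒non-root y↘x)) λ ()

  watershed-forest : ∀ {Y} → Acc ℕ._<_ (count (V Y)) → IsWatershedSubgraph Y →
                     RootedForest (InMin M F) Y × IsTight Y
  watershed-forest {Y} (acc smaller) W with anySubset? (nonRootVertex? Y)
  ... | no ¬nonroot = all-roots-forest W λ x x∈Y → ¬-not λ x-nonroot → ¬nonroot (x , x∈Y , x-nonroot)
  ... | yes (_ , y-nonroot) with maximum-on ℤP.≤-totalOrder F (nonRootVertex? Y) y-nonroot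
  ...   | v , (v∈Y , v-nonroot) , v-highest with non-root⇒descends (vertex-face W v∈Y) v-nonroot
  ...     | p , v↘p = step Y v p free roots-kept (proj₁ rest) , tight-step (proj₂ rest)
    where
    open Peel W v∈Y v↘p v-highest
    rest = watershed-forest (smaller count-decreases) W′

  watershedForest⇒subgraph : ∀ {G} → IsWatershedForest d M F G → IsWatershedSubgraph G
  watershedForest⇒subgraph {G} (G-faces , G-edges) = record
    { vertex-face    = Equivalence.to (G-faces _)
    ; roots⊆         = Equivalence.from (G-faces _) ∘ proj₁ ∘ isRoot-sound
    ; edge⇔          = λ x y → mk⇔ (λ xy∈G → with-vertices (Equivalence.to (G-edges x y) xy∈G))
                                   (Equivalence.from (G-edges x y) ∘ proj₂ ∘ proj₂)
    ; descent-closed = λ _ x↘p → Equivalence.from (G-faces _) (proj₁ (proj₂ (proj₁ x↘p)))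
    }
    where
    with-vertices : ∀ {x y} → IsWatershedEdge x y → V G x ≡ true × V G y ≡ true × IsWatershedEdge x y
    with-vertices xy@((x-face , y-face , _) , _) =
      Equivalence.from (G-faces _) x-face , Equivalence.from (G-faces _) y-face , xy

  watershedForest-spanning : ∀ {G y} → y ∈ᶜ M → IsWatershedForest d M F G →
                             IsSpanningForest d M F G × IsTight G
  watershedForest-spanning {G} y∈M G-watershed@(G-faces , _) =
    (subgraph , rooted , (λ x → Equivalence.from (G-faces x))) , proj₂ forest-tight
    where
    W = watershedForest⇒subgraph G-watershed
    forest-tight = watershed-forest (<-wellFounded _) W
    edge-ends : ∀ x y → E G x y ≡ true → V G x ≡ true × V G y ≡ true
    edge-ends x y xy∈G = let x∈G , y∈G , _ = Equivalence.to (edge⇔ W x y) xy∈G in x∈G , y∈G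
    subgraph : IsSubgraphΥ d M G
    subgraph = (λ _ → vertex-face W) , proj₁ (edges-in-Υ W) , edge-ends , proj₂ (edges-in-Υ W)
    rooted : IsForestRootedBy (InMin M F) G
    rooted = (_ , IsRoot⇒InMin (proj₂ (∃-root y∈M))) ,
             (λ _ → roots⊆ W ∘ Equivalence.to InMin⇔isRoot) , proj₁ forest-tight

  spanning-EdgesInΥ : ∀ {Y} → IsSpanningForest d M F Y → EdgesInΥ Y
  spanning-EdgesInΥ ((_ , facet-edges , _ , E-sym) , _) = facet-edges , E-sym

  spanning-same-vertices : ∀ {Y Y′} → IsSpanningForest d M F Y → IsSpanningForest d M F Y′ →
                           ∀ x → V Y x ≡ V Y′ x
  spanning-same-vertices ((Y-faces , _) , _ , Y-spans) ((Y′-faces , _) , _ , Y′-spans) x =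
    ≡true-ext (mk⇔ (Y′-spans x ∘ Y-faces x) (Y-spans x ∘ Y′-faces x))

  tight-minimal : ∀ {Y} → IsSpanningForest d M F Y → IsTight Y →
                  ∀ Y′ → IsSpanningForest d M F Y′ → weight F Y ≤ weight F Y′
  tight-minimal {Y} Y-spanning tight Y′ Y′-spanning@(_ , (_ , _ , forest′) , _) =
    +-cancelʳ-≤ (Φ isRoot) (begin
      weight F Y + Φ isRoot   ≡⟨ tight ⟩
      Φ (V Y)                 ≡⟨ ℤSum.∑⟨⟩-cong F (spanning-same-vertices Y-spanning Y′-spanning) ⟩
      Φ (V Y′)                ≤⟨ forest-bound forest′ (spanning-EdgesInΥ Y′-spanning) ⟩
      weight F Y′ + Φ isRoot  ∎)
    where open ℤP.≤-Reasoning

  minimum-tight : ∀ {G Y} → IsSpanningForest d M F G → IsTight G →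
                  IsMinimumSpanningForest d M F Y → IsTight Y
  minimum-tight {G} {Y} G-spanning G-tight (Y-spanning , Y-minimum) = begin
    weight F Y + Φ isRoot  ≡⟨ cong (_+ Φ isRoot) same-weight ⟩
    weight F G + Φ isRoot  ≡⟨ G-tight ⟩
    Φ (V G)                ≡⟨ ℤSum.∑⟨⟩-cong F (spanning-same-vertices G-spanning Y-spanning) ⟩
    Φ (V Y)                ∎
    where
    open ≡-Reasoning
    same-weight =
      ℤP.≤-antisym (Y-minimum G G-spanning) (tight-minimal G-spanning G-tight Y Y-spanning)

  tight-spanning-edges : ∀ {Y} → IsSpanningForest d M F Y → IsTight Y →
                         ∀ x y → E Y x y ≡ true ⇔ IsWatershedEdge x y
  tight-spanning-edges {Y} Y-spanning@(_ , (_ , _ , forest) , Y-spans) tight x y =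
    mk⇔ (proj₁ descending x y) watershed∈Y
    where
    descending = tight⇒descending forest (spanning-EdgesInΥ Y-spanning) tight
    descent∈Y : ∀ {a b} → Descends a b → E Y a b ≡ true
    descent∈Y a↘b with proj₂ descending _ (Y-spans _ (proj₁ (proj₁ a↘b))) (descends⇒non-root a↘b)
    ... | c , ac∈Y , a↘c = subst (λ c → E Y _ c ≡ true) (descends-unique a↘c a↘b) ac∈Y
    watershed∈Y : IsWatershedEdge x y → E Y x y ≡ true
    watershed∈Y xy with watershedEdge⇒descends xy
    ... | inj₁ x↘y = descent∈Y x↘y
    ... | inj₂ y↘x = trans (proj₂ (spanning-EdgesInΥ Y-spanning) x y) (descent∈Y y↘x)

  tight-spanning-unique : ∀ {G Y} → IsSpanningForest d M F G → IsTight G →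
                          IsSpanningForest d M F Y → IsTight Y → Y ≈ᴳ G
  tight-spanning-unique G-spanning G-tight Y-spanning Y-tight =
    spanning-same-vertices Y-spanning G-spanning ,
    λ x y → ≡true-ext (⇔-sym (tight-spanning-edges G-spanning G-tight x y)
                         ⇔-∘ tight-spanning-edges Y-spanning Y-tight x y)

theorem9 : ∀ {n} (d : ℕ) (M : Subset n → Bool) (F : Subset n → ℤ) →
    IsNormalPseudomanifold d M → IsMorseStack M F →
    (G : Graph n) → IsWatershedForest d M F G →
    IsMinimumSpanningForest d M F G ×
    (∀ Y → IsMinimumSpanningForest d M F Y → Y ≈ᴳ G)
theorem9 d M F (1≤d , (_ , M-closed) , ((_ , y∈M) , _) , M-pure , M-cofaces , _) morse G G-watershed =
  (G-spanning , tight-minimal G-spanning G-tight) ,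
  λ Y Y-minimum@(Y-spanning , _) →
    tight-spanning-unique G-spanning G-tight Y-spanning (minimum-tight G-spanning G-tight Y-minimum)
  where
  open MorseStack 1≤d M-closed M-pure M-cofaces morse
  G-spanning-tight = watershedForest-spanning y∈M G-watershed
  G-spanning = proj₁ G-spanning-tight
  G-tight = proj₂ G-spanning-tight
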